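{- Let $G=(V,E)$ be a finite simple graph. Then $$\frac{1}{2!}\frac{d^2}{dx^2}C(G,x)=\sum_{e\in E(G)} C(G[N_G(e)],x).$$
   Context: For a graph $H$, $c_k(H)$ is the number of complete subgraphs of $H$ on $k$ vertices, and the clique polynomial is $C(H,x)=1+\sum_{k=1}^{\omega(H)} c_k(H)x^k$, where $\omega(H)$ is the size of a largest clique (so the graph with no vertices has clique polynomial $1$). For an edge $e=\{u,v\}$, $N_G(e)=N_G(u)\cap N_G(v)$ is the set of common neighbours of its end vertices, where $N_G(w)$ is the set of vertices adjacent to $w$; $G[S]$ denotes the subgraph of $G$ induced by a vertex set $S$. -}

module Defs where

open import Data.Bool using (Bool; true; false; _∧_; if_then_else_)
open import Data.Nat using (ℕ; zero; suc; _+_; _*_; _≡ᵇ_; _<ᵇ_)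
open import Data.Fin using (Fin; toℕ)
open import Data.Fin.Subset using (Subset; ∣_∣)
open import Data.List using (List; []; _∷_; _++_; map; filter; length; foldr; concatMap; allFin)
open import Data.List.Relation.Unary.All using (All)
open import Data.Vec using (Vec; []; _∷_; tabulate; toList; lookup)
import Data.Vec as Vec
open import Data.Product using (_×_; _,_)
open import Relation.Binary.PropositionalEquality using (_≡_; refl)
open import Relation.Nullary.Decidable using (does)
open import Data.Bool.Properties using (T?)
open import Data.Bool using (T)

record Graph (n : ℕ) : Set where
  field
    adj    : Fin n → Fin n → Bool
    sym    : ∀ i j → adj i j ≡ adj j i
    irrefl : ∀ i → adj i i ≡ false
open Graph public

allSubsets : (n : ℕ) → List (Subset n)
allSubsets zero    = [] ∷ []
allSubsets (suc n) = map (false ∷_) (allSubsets n) ++ map (true ∷_) (allSubsets n)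

elems : ∀ {n} → Subset n → List (Fin n)
elems {n} S = filter (λ i → T? (lookup S i)) (allFin n)

isCliqueᵇ : ∀ {n} → Graph n → Subset n → Bool
isCliqueᵇ {n} G S =
  foldr _∧_ true
    (concatMap (λ i → map (λ j → if toℕ i ≡ᵇ toℕ j then true else adj G i j) (elems S)) (elems S))

-- c_k(G): number of complete subgraphs of G on k vertices
-- (c_0 = 1, the empty clique, giving the constant term 1 of C(G,x))
cliqueCount : ∀ {n} → Graph n → ℕ → ℕ
cliqueCount {n} G k =
  length (filter (λ S → T? (isCliqueᵇ G S ∧ (∣ S ∣ ≡ᵇ k))) (allSubsets n))

-- Polynomials with natural-number coefficients, represented by their
-- coefficient sequences: p k = coefficient of x^k.
Poly : Set
Poly = ℕ → ℕ

cliquePoly : ∀ {n} → Graph n → Poly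
cliquePoly G = cliqueCount G

deriv : Poly → Poly
deriv p k = suc k * p (suc k)

scale : ℕ → Poly → Poly
scale c p k = c * p k

sumPoly : List Poly → Poly
sumPoly []       k = 0
sumPoly (p ∷ ps) k = p k + sumPoly ps k

induced : ∀ {n} → Graph n → (S : Subset n) → Graph (length (elems S))
induced G S = record
  { adj    = λ i j → adj G (Data.List.lookup (elems S) i) (Data.List.lookup (elems S) j)
  ; sym    = λ i j → sym G (Data.List.lookup (elems S) i) (Data.List.lookup (elems S) j)
  ; irrefl = λ i → irrefl G (Data.List.lookup (elems S) i)
  }

nbhd : ∀ {n} → Graph n → Fin n → Subset n
nbhd G w = tabulate (λ v → adj G w v)

edgeNbhd : ∀ {n} → Graph n → Fin n → Fin n → Subset n
edgeNbhd G u v = nbhd G u Data.Fin.Subset.∩ nbhd G v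

-- E(G): each edge {u,v} listed once, as the pair (u,v) with u < v
edges : ∀ {n} → Graph n → List (Fin n × Fin n)
edges {n} G =
  filter (λ { (u , v) → T? ((toℕ u <ᵇ toℕ v) ∧ adj G u v) })
    (concatMap (λ u → map (λ v → (u , v)) (allFin n)) (allFin n))

-- Each (k+1)-clique contains k+1 vertices, and the cliques through a vertex v are v plus a
-- clique of G[N(v)]; hence (k+1)·c_{k+1}(G) = Σ_v c_k(G[N(v)]), i.e. C'(G,x) = Σ_v C(G[N(v)],x).
-- Applying this twice (the neighbourhood of v inside G[N(u)] is N(u) ∩ N(v)) gives
-- C''(G,x) = Σ over ordered adjacent pairs (u,v) of C(G[N(u) ∩ N(v)],x), and every edge
-- contributes two ordered pairs, which is the factor 2!.
module Submission where

open import Defs renaming (sym to adj-sym; irrefl to adj-irrefl)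
open import Data.Bool using (Bool; true; false; _∧_; if_then_else_)
open import Data.Bool.Properties using (T?; ∧-assoc; ∧-comm; ∧-zeroʳ; ∧-idem)
open import Data.Nat using (ℕ; zero; suc; _+_; _*_; _≡ᵇ_; _<ᵇ_; _!)
open import Data.Nat.Properties using (+-assoc; +-identityʳ; *-zeroʳ; *-distribˡ-+; <-asym; <ᵇ-reflects-<; ≤-antisym; ≮⇒≥)
open import Data.Nat.Solver using (module +-*-Solver)
open import Data.Fin using (Fin; toℕ) renaming (zero to fzero; suc to fsuc)
open import Data.Fin.Properties using (toℕ-injective)
open import Data.Fin.Subset using (Subset; ∣_∣)
open import Data.List using (List; []; _∷_; _++_; map; concatMap; filter; filterᵇ; length; allFin; tabulate)
open import Data.Bool.ListAction using (and; all)
import Data.List as List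
open import Data.List.Properties using (filter-++; length-++; length-map; map-tabulate; tabulate-lookup; filter-all)
open import Data.List.Relation.Unary.All using (universal)
open import Data.Vec using (_∷_; lookup)
open import Data.Vec.Properties using (lookup-zipWith; lookup∘tabulate)
open import Data.Product using (_×_; _,_; proj₁; proj₂)
open import Data.Unit using (tt)
open import Data.Empty using (⊥-elim)
open import Function using (_∘_; id)
open import Level using (0ℓ)
open import Relation.Unary using (Pred; Decidable)
open import Relation.Nullary.Decidable using (does)
open import Relation.Nullary.Reflects using (ofʸ; ofⁿ)
open import Relation.Binary.PropositionalEquality using (_≡_; refl; sym; trans; cong; cong₂; module ≡-Reasoning)

private variable
  A B : Set

∑ : List A → (A → ℕ) → ℕ
∑ []       f = 0
∑ (x ∷ xs) f = f x + ∑ xs f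

infix 5 ∑
syntax ∑ xs (λ x → e) = ∑[ x ∈ xs ] e

∑-cong : ∀ {f g : A → ℕ} xs → (∀ x → f x ≡ g x) → ∑ xs f ≡ ∑ xs g
∑-cong []       f≗g = refl
∑-cong (x ∷ xs) f≗g = cong₂ _+_ (f≗g x) (∑-cong xs f≗g)

∑-zero : (xs : List A) → ∑[ x ∈ xs ] 0 ≡ 0
∑-zero []       = refl
∑-zero (x ∷ xs) = ∑-zero xs

∑-distrib-+ : ∀ (f g : A → ℕ) xs → ∑[ x ∈ xs ] (f x + g x) ≡ ∑ xs f + ∑ xs g
∑-distrib-+ f g []       = refl
∑-distrib-+ f g (x ∷ xs) = begin
  f x + g x + (∑[ x ∈ xs ] f x + g x) ≡⟨ cong (f x + g x +_) (∑-distrib-+ f g xs) ⟩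
  f x + g x + (∑ xs f + ∑ xs g)       ≡⟨ solve 4 (λ a b c d → a :+ b :+ (c :+ d) := a :+ c :+ (b :+ d)) refl (f x) (g x) (∑ xs f) (∑ xs g) ⟩
  f x + ∑ xs f + (g x + ∑ xs g)       ∎
  where open ≡-Reasoning; open +-*-Solver

*-distribˡ-∑ : ∀ c (f : A → ℕ) xs → c * ∑ xs f ≡ (∑[ x ∈ xs ] c * f x)
*-distribˡ-∑ c f []       = *-zeroʳ c
*-distribˡ-∑ c f (x ∷ xs) = trans (*-distribˡ-+ c (f x) (∑ xs f)) (cong (c * f x +_) (*-distribˡ-∑ c f xs))

∑-comm : ∀ (h : A → B → ℕ) xs ys → ∑[ x ∈ xs ] ∑ ys (h x) ≡ ∑[ y ∈ ys ] ∑[ x ∈ xs ] h x y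
∑-comm h []       ys = sym (∑-zero ys)
∑-comm h (x ∷ xs) ys = trans (cong (∑ ys (h x) +_) (∑-comm h xs ys)) (sym (∑-distrib-+ (h x) _ ys))

∑-++ : ∀ (f : A → ℕ) xs ys → ∑ (xs ++ ys) f ≡ ∑ xs f + ∑ ys f
∑-++ f []       ys = refl
∑-++ f (x ∷ xs) ys = trans (cong (f x +_) (∑-++ f xs ys)) (sym (+-assoc (f x) _ _))

∑-map : ∀ (f : B → ℕ) (g : A → B) xs → ∑ (map g xs) f ≡ ∑ xs (f ∘ g)
∑-map f g []       = refl
∑-map f g (x ∷ xs) = cong (f (g x) +_) (∑-map f g xs)

∑-concatMap : ∀ (f : B → ℕ) (g : A → List B) xs → ∑ (concatMap g xs) f ≡ ∑[ x ∈ xs ] ∑ (g x) f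
∑-concatMap f g []       = refl
∑-concatMap f g (x ∷ xs) = trans (∑-++ f (g x) (concatMap g xs)) (cong (∑ (g x) f +_) (∑-concatMap f g xs))

∑-filter : ∀ {P : Pred A 0ℓ} (P? : Decidable P) (f : A → ℕ) xs →
  ∑ (filter P? xs) f ≡ (∑[ x ∈ xs ] (if does (P? x) then f x else 0))
∑-filter P? f []       = refl
∑-filter P? f (x ∷ xs) with does (P? x)
... | true  = cong (f x +_) (∑-filter P? f xs)
... | false = ∑-filter P? f xs

filterᵇ-cong : ∀ {p q : A → Bool} xs → (∀ x → p x ≡ q x) → filterᵇ p xs ≡ filterᵇ q xs
filterᵇ-cong []       p≗q = refl
filterᵇ-cong {p = p} {q} (x ∷ xs) p≗q with p x | q x | p≗q x
... | true  | true  | refl = cong (x ∷_) (filterᵇ-cong xs p≗q)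
... | false | false | refl = filterᵇ-cong xs p≗q

filterᵇ-map : ∀ (p : B → Bool) (f : A → B) xs → filterᵇ p (map f xs) ≡ map f (filterᵇ (p ∘ f) xs)
filterᵇ-map p f []       = refl
filterᵇ-map p f (x ∷ xs) with p (f x)
... | true  = cong (f x ∷_) (filterᵇ-map p f xs)
... | false = filterᵇ-map p f xs

filterᵇ-filterᵇ : ∀ (p q : A → Bool) xs → filterᵇ p (filterᵇ q xs) ≡ filterᵇ (λ x → q x ∧ p x) xs
filterᵇ-filterᵇ p q []       = refl
filterᵇ-filterᵇ p q (x ∷ xs) with q x
... | false = filterᵇ-filterᵇ p q xs
... | true with p x
...   | true  = cong (x ∷_) (filterᵇ-filterᵇ p q xs)
...   | false = filterᵇ-filterᵇ p q xs

filterᵇ-comm : ∀ (p q : A → Bool) xs → filterᵇ p (filterᵇ q xs) ≡ filterᵇ q (filterᵇ p xs)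
filterᵇ-comm p q xs = begin
  filterᵇ p (filterᵇ q xs)         ≡⟨ filterᵇ-filterᵇ p q xs ⟩
  filterᵇ (λ x → q x ∧ p x) xs     ≡⟨ filterᵇ-cong xs (λ x → ∧-comm (q x) (p x)) ⟩
  filterᵇ (λ x → p x ∧ q x) xs     ≡⟨ sym (filterᵇ-filterᵇ q p xs) ⟩
  filterᵇ q (filterᵇ p xs)         ∎
  where open ≡-Reasoning


all-cong : ∀ {p q : A → Bool} xs → (∀ x → p x ≡ q x) → all p xs ≡ all q xs
all-cong []       p≗q = refl
all-cong (x ∷ xs) p≗q = cong₂ _∧_ (p≗q x) (all-cong xs p≗q)

all-map : ∀ (p : B → Bool) (f : A → B) xs → all p (map f xs) ≡ all (p ∘ f) xs
all-map p f []       = refl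
all-map p f (x ∷ xs) = cong (p (f x) ∧_) (all-map p f xs)

all-∧ : ∀ (p q : A → Bool) xs → all (λ x → p x ∧ q x) xs ≡ all p xs ∧ all q xs
all-∧ p q []       = refl
all-∧ p q (x ∷ xs) = trans (cong ((p x ∧ q x) ∧_) (all-∧ p q xs)) (interchange (p x) (q x) (all p xs) (all q xs))
  where
  interchange : ∀ a b c d → (a ∧ b) ∧ (c ∧ d) ≡ (a ∧ c) ∧ (b ∧ d)
  interchange true  true  c d = refl
  interchange true  false c d = sym (∧-zeroʳ c)
  interchange false b     c d = refl

all-true : (xs : List A) → all (λ _ → true) xs ≡ true
all-true []       = refl
all-true (x ∷ xs) = all-true xs

and-concatMap : ∀ (f : A → List Bool) xs → and (concatMap f xs) ≡ all (and ∘ f) xs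
and-concatMap f []       = refl
and-concatMap f (x ∷ xs) = begin
  and (f x ++ concatMap f xs)         ≡⟨ and-++ (f x) (concatMap f xs) ⟩
  and (f x) ∧ and (concatMap f xs)    ≡⟨ cong (and (f x) ∧_) (and-concatMap f xs) ⟩
  and (f x) ∧ all (and ∘ f) xs        ∎
  where
  open ≡-Reasoning
  and-++ : ∀ bs cs → and (bs ++ cs) ≡ and bs ∧ and cs
  and-++ []       cs = refl
  and-++ (b ∷ bs) cs = trans (cong (b ∧_) (and-++ bs cs)) (sym (∧-assoc b (and bs) (and cs)))

length-filterᵇ-false : (xs : List A) → length (filterᵇ (λ _ → false) xs) ≡ 0
length-filterᵇ-false []       = refl
length-filterᵇ-false (x ∷ xs) = length-filterᵇ-false xs

length-filterᵇ-∧ : ∀ b (p : A → Bool) xs → length (filterᵇ (λ x → b ∧ p x) xs) ≡ (if b then length (filterᵇ p xs) else 0)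
length-filterᵇ-∧ true  p xs = refl
length-filterᵇ-∧ false p xs = length-filterᵇ-false xs

module _ {V : Set} (R : V → V → Bool) where

  -- On a duplicate-free list: a (k+1)-clique either avoids the head x, or is x together
  -- with a k-clique among the neighbours of x in the tail.
  countCliques : List V → ℕ → ℕ
  countCliques []      zero    = 1
  countCliques []      (suc k) = 0
  countCliques (x ∷ L) zero    = countCliques L zero
  countCliques (x ∷ L) (suc k) = countCliques L (suc k) + countCliques (filterᵇ (R x) L) k

  countCliques-zero : ∀ L → countCliques L 0 ≡ 1
  countCliques-zero []      = refl
  countCliques-zero (x ∷ L) = countCliques-zero L

  countCliques-if∷ : ∀ b x L k →
    countCliques (if b then x ∷ L else L) (suc k)
      ≡ countCliques L (suc k) + (if b then countCliques (filterᵇ (R x) L) k else 0)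
  countCliques-if∷ true  x L k = refl
  countCliques-if∷ false x L k = sym (+-identityʳ _)

countCliques-map : ∀ {V W : Set} (R : W → W → Bool) (f : V → W) L k →
  countCliques R (map f L) k ≡ countCliques (λ i j → R (f i) (f j)) L k
countCliques-map R f []      zero    = refl
countCliques-map R f []      (suc k) = refl
countCliques-map R f (x ∷ L) zero    = countCliques-map R f L zero
countCliques-map R f (x ∷ L) (suc k) = cong₂ _+_ (countCliques-map R f L (suc k)) (begin
  countCliques R (filterᵇ (R (f x)) (map f L)) k            ≡⟨ cong (λ M → countCliques R M k) (filterᵇ-map (R (f x)) f L) ⟩
  countCliques R (map f (filterᵇ (R (f x) ∘ f) L)) k         ≡⟨ countCliques-map R f (filterᵇ (R (f x) ∘ f) L) k ⟩
  countCliques (λ i j → R (f i) (f j)) (filterᵇ (R (f x) ∘ f) L) k ∎)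
  where open ≡-Reasoning

module _ {V : Set} (R : V → V → Bool) (R-sym : ∀ x y → R x y ≡ R y x) (R-irrefl : ∀ x → R x x ≡ false) where

  private
    cc = countCliques R

  filterᵇ-self : ∀ x L → filterᵇ (R x) (x ∷ L) ≡ filterᵇ (R x) L
  filterᵇ-self x L with R x x | R-irrefl x
  ... | false | refl = refl

  countCliques-nbhd-∷ : ∀ u x L k →
    cc (filterᵇ (R u) (x ∷ L)) (suc k)
      ≡ cc (filterᵇ (R u) L) (suc k) + (if R x u then cc (filterᵇ (R u) (filterᵇ (R x) L)) k else 0)
  countCliques-nbhd-∷ u x L k with R u x | R x u | R-sym u x
  ... | true  | true  | refl = cong (λ M → cc (filterᵇ (R u) L) (suc k) + cc M k) (filterᵇ-comm (R x) (R u) L)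
  ... | false | false | refl = sym (+-identityʳ _)

  ∑-countCliques-nbhd : ∀ k L → (∑[ u ∈ L ] cc (filterᵇ (R u) L) k) ≡ suc k * cc L (suc k)
  ∑-countCliques-nbhd zero    []      = refl
  ∑-countCliques-nbhd zero    (x ∷ L) = begin
    (∑[ u ∈ x ∷ L ] cc (filterᵇ (R u) (x ∷ L)) 0)
      ≡⟨ ∑-cong (x ∷ L) (λ u → countCliques-zero R (filterᵇ (R u) (x ∷ L))) ⟩
    1 + (∑[ u ∈ L ] 1)
      ≡⟨ cong suc (trans (∑-cong L (λ u → sym (countCliques-zero R (filterᵇ (R u) L)))) (∑-countCliques-nbhd zero L)) ⟩
    1 + 1 * cc L 1
      ≡⟨ solve 1 (λ a → con 1 :+ con 1 :* a := con 1 :* (a :+ con 1)) refl (cc L 1) ⟩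
    1 * (cc L 1 + 1)
      ≡⟨ cong (λ c → 1 * (cc L 1 + c)) (sym (countCliques-zero R (filterᵇ (R x) L))) ⟩
    1 * cc (x ∷ L) 1 ∎
    where
    open ≡-Reasoning
    open +-*-Solver
  ∑-countCliques-nbhd (suc k) []      = sym (*-zeroʳ (suc (suc k)))
  ∑-countCliques-nbhd (suc k) (x ∷ L) = begin
    cc (filterᵇ (R x) (x ∷ L)) (suc k) + (∑[ u ∈ L ] cc (filterᵇ (R u) (x ∷ L)) (suc k))
      ≡⟨ cong₂ _+_ (cong (λ M → cc M (suc k)) (filterᵇ-self x L)) (∑-cong L (λ u → countCliques-nbhd-∷ u x L k)) ⟩
    cc N (suc k) + (∑[ u ∈ L ] cc (filterᵇ (R u) L) (suc k) + (if R x u then cc (filterᵇ (R u) N) k else 0))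
      ≡⟨ cong (cc N (suc k) +_) (∑-distrib-+ _ _ L) ⟩
    cc N (suc k) + ((∑[ u ∈ L ] cc (filterᵇ (R u) L) (suc k)) + (∑[ u ∈ L ] (if R x u then cc (filterᵇ (R u) N) k else 0)))
      ≡⟨ cong (λ s → cc N (suc k) + ((∑[ u ∈ L ] cc (filterᵇ (R u) L) (suc k)) + s)) (sym (∑-filter (T? ∘ R x) _ L)) ⟩
    cc N (suc k) + ((∑[ u ∈ L ] cc (filterᵇ (R u) L) (suc k)) + (∑[ u ∈ N ] cc (filterᵇ (R u) N) k))
      ≡⟨ cong (cc N (suc k) +_) (cong₂ _+_ (∑-countCliques-nbhd (suc k) L) (∑-countCliques-nbhd k N)) ⟩
    cc N (suc k) + (suc (suc k) * cc L (suc (suc k)) + suc k * cc N (suc k))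
      ≡⟨ solve 3 (λ k a b → b :+ ((con 2 :+ k) :* a :+ (con 1 :+ k) :* b) := (con 2 :+ k) :* (a :+ b)) refl k (cc L (suc (suc k))) (cc N (suc k)) ⟩
    suc (suc k) * cc (x ∷ L) (suc (suc k)) ∎
    where
    open ≡-Reasoning
    open +-*-Solver
    N = filterᵇ (R x) L

removeZero : ∀ {n} → Graph (suc n) → Graph n
removeZero G = record
  { adj    = λ i j → adj G (fsuc i) (fsuc j)
  ; sym    = λ i j → adj-sym G (fsuc i) (fsuc j)
  ; irrefl = λ i → adj-irrefl G (fsuc i)
  }

module _ {n : ℕ} where

  isCliqueOnᵇ : Graph n → List (Fin n) → Bool
  isCliqueOnᵇ G E = all (λ i → all (λ j → if toℕ i ≡ᵇ toℕ j then true else adj G i j) E) E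

  isCliqueᵇ-isCliqueOnᵇ : ∀ (G : Graph n) S → isCliqueᵇ G S ≡ isCliqueOnᵇ G (elems S)
  isCliqueᵇ-isCliqueOnᵇ G S = and-concatMap _ (elems S)

  countSubsets : (Subset n → Bool) → ℕ
  countSubsets W = length (filterᵇ W (allSubsets n))

  countSubsets-cong : ∀ {W W′ : Subset n → Bool} → (∀ S → W S ≡ W′ S) → countSubsets W ≡ countSubsets W′
  countSubsets-cong W≗W′ = cong length (filterᵇ-cong (allSubsets n) W≗W′)

  cliqueWithinᵇ : Graph n → (Fin n → Bool) → ℕ → Subset n → Bool
  cliqueWithinᵇ G p k S = all p (elems S) ∧ (isCliqueOnᵇ G (elems S) ∧ (∣ S ∣ ≡ᵇ k))

countSubsets-suc : ∀ {n} (W : Subset (suc n) → Bool) →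
  countSubsets W ≡ countSubsets (W ∘ (false ∷_)) + countSubsets (W ∘ (true ∷_))
countSubsets-suc {n} W = begin
  length (filterᵇ W (map (false ∷_) X ++ map (true ∷_) X))
    ≡⟨ cong length (filter-++ (T? ∘ W) (map (false ∷_) X) (map (true ∷_) X)) ⟩
  length (filterᵇ W (map (false ∷_) X) ++ filterᵇ W (map (true ∷_) X))
    ≡⟨ length-++ (filterᵇ W (map (false ∷_) X)) ⟩
  length (filterᵇ W (map (false ∷_) X)) + length (filterᵇ W (map (true ∷_) X))
    ≡⟨ cong₂ _+_ (trans (cong length (filterᵇ-map W (false ∷_) X)) (length-map (false ∷_) (filterᵇ (W ∘ (false ∷_)) X)))
                 (trans (cong length (filterᵇ-map W (true ∷_) X)) (length-map (true ∷_) (filterᵇ (W ∘ (true ∷_)) X))) ⟩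
  countSubsets (W ∘ (false ∷_)) + countSubsets (W ∘ (true ∷_)) ∎
  where
  open ≡-Reasoning
  X = allSubsets n

filterᵇ-tabulate-suc : ∀ {n} (p : Fin (suc n) → Bool) →
  filterᵇ p (tabulate fsuc) ≡ map fsuc (filterᵇ (p ∘ fsuc) (allFin n))
filterᵇ-tabulate-suc {n} p = trans (cong (filterᵇ p) (sym (map-tabulate id fsuc))) (filterᵇ-map p fsuc (allFin n))

filterᵇ-allFin-suc : ∀ {n} (p : Fin (suc n) → Bool) →
  filterᵇ p (allFin (suc n))
    ≡ (if p fzero then fzero ∷ map fsuc (filterᵇ (p ∘ fsuc) (allFin n)) else map fsuc (filterᵇ (p ∘ fsuc) (allFin n)))
filterᵇ-allFin-suc p with p fzero
... | true  = cong (fzero ∷_) (filterᵇ-tabulate-suc p)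
... | false = filterᵇ-tabulate-suc p

elems-false∷ : ∀ {n} (T : Subset n) → elems (false ∷ T) ≡ map fsuc (elems T)
elems-false∷ T = filterᵇ-allFin-suc (lookup (false ∷ T))

elems-true∷ : ∀ {n} (T : Subset n) → elems (true ∷ T) ≡ fzero ∷ map fsuc (elems T)
elems-true∷ T = filterᵇ-allFin-suc (lookup (true ∷ T))

module _ {n : ℕ} (G : Graph (suc n)) where

  private
    adjOrSelf : Fin (suc n) → Fin (suc n) → Bool
    adjOrSelf i j = if toℕ i ≡ᵇ toℕ j then true else adj G i j

    isCliqueOnᵇ-tail : ∀ E → all (λ i → all (adjOrSelf (fsuc i)) (map fsuc E)) E ≡ isCliqueOnᵇ (removeZero G) E
    isCliqueOnᵇ-tail E = all-cong E (λ i → all-map (adjOrSelf (fsuc i)) fsuc E)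

  isCliqueOnᵇ-map-suc : ∀ E → isCliqueOnᵇ G (map fsuc E) ≡ isCliqueOnᵇ (removeZero G) E
  isCliqueOnᵇ-map-suc E = trans (all-map _ fsuc E) (isCliqueOnᵇ-tail E)

  isCliqueOnᵇ-zero∷ : ∀ E → isCliqueOnᵇ G (fzero ∷ map fsuc E) ≡ all (adj G fzero ∘ fsuc) E ∧ isCliqueOnᵇ (removeZero G) E
  isCliqueOnᵇ-zero∷ E = begin
    all (adjOrSelf fzero) (map fsuc E) ∧ all (λ i → adjOrSelf i fzero ∧ all (adjOrSelf i) (map fsuc E)) (map fsuc E)
      ≡⟨ cong₂ _∧_ (all-map (adjOrSelf fzero) fsuc E) (all-map _ fsuc E) ⟩
    a ∧ all (λ i → adj G (fsuc i) fzero ∧ all (adjOrSelf (fsuc i)) (map fsuc E)) E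
      ≡⟨ cong (a ∧_) (all-∧ _ _ E) ⟩
    a ∧ (all (λ i → adj G (fsuc i) fzero) E ∧ all (λ i → all (adjOrSelf (fsuc i)) (map fsuc E)) E)
      ≡⟨ cong (a ∧_) (cong₂ _∧_ (all-cong E (λ i → adj-sym G (fsuc i) fzero)) (isCliqueOnᵇ-tail E)) ⟩
    a ∧ (a ∧ isCliqueOnᵇ (removeZero G) E)
      ≡⟨ sym (∧-assoc a a _) ⟩
    (a ∧ a) ∧ isCliqueOnᵇ (removeZero G) E
      ≡⟨ cong (_∧ isCliqueOnᵇ (removeZero G) E) (∧-idem a) ⟩
    a ∧ isCliqueOnᵇ (removeZero G) E ∎
    where
    open ≡-Reasoning
    a = all (adj G fzero ∘ fsuc) E

  cliqueWithinᵇ-false∷ : ∀ p k T → cliqueWithinᵇ G p k (false ∷ T) ≡ cliqueWithinᵇ (removeZero G) (p ∘ fsuc) k T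
  cliqueWithinᵇ-false∷ p k T = begin
    all p (elems (false ∷ T)) ∧ (isCliqueOnᵇ G (elems (false ∷ T)) ∧ (∣ T ∣ ≡ᵇ k))
      ≡⟨ cong (λ E → all p E ∧ (isCliqueOnᵇ G E ∧ (∣ T ∣ ≡ᵇ k))) (elems-false∷ T) ⟩
    all p (map fsuc (elems T)) ∧ (isCliqueOnᵇ G (map fsuc (elems T)) ∧ (∣ T ∣ ≡ᵇ k))
      ≡⟨ cong₂ (λ a c → a ∧ (c ∧ (∣ T ∣ ≡ᵇ k))) (all-map p fsuc (elems T)) (isCliqueOnᵇ-map-suc (elems T)) ⟩
    cliqueWithinᵇ (removeZero G) (p ∘ fsuc) k T ∎
    where open ≡-Reasoning

  cliqueWithinᵇ-true∷-zero : ∀ p T → cliqueWithinᵇ G p 0 (true ∷ T) ≡ false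
  cliqueWithinᵇ-true∷-zero p T =
    trans (cong (all p (elems (true ∷ T)) ∧_) (∧-zeroʳ (isCliqueOnᵇ G (elems (true ∷ T))))) (∧-zeroʳ _)

  cliqueWithinᵇ-true∷-suc : ∀ p k T →
    cliqueWithinᵇ G p (suc k) (true ∷ T)
      ≡ p fzero ∧ cliqueWithinᵇ (removeZero G) (λ i → p (fsuc i) ∧ adj G fzero (fsuc i)) k T
  cliqueWithinᵇ-true∷-suc p k T = begin
    all p (elems (true ∷ T)) ∧ (isCliqueOnᵇ G (elems (true ∷ T)) ∧ s)
      ≡⟨ cong (λ E → all p E ∧ (isCliqueOnᵇ G E ∧ s)) (elems-true∷ T) ⟩
    all p (fzero ∷ map fsuc E) ∧ (isCliqueOnᵇ G (fzero ∷ map fsuc E) ∧ s)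
      ≡⟨ cong₂ (λ a c → (p fzero ∧ a) ∧ (c ∧ s)) (all-map p fsuc E) (isCliqueOnᵇ-zero∷ E) ⟩
    (p fzero ∧ all (p ∘ fsuc) E) ∧ ((all (adj G fzero ∘ fsuc) E ∧ isCliqueOnᵇ (removeZero G) E) ∧ s)
      ≡⟨ shuffle (p fzero) (all (p ∘ fsuc) E) (all (adj G fzero ∘ fsuc) E) _ s ⟩
    p fzero ∧ ((all (p ∘ fsuc) E ∧ all (adj G fzero ∘ fsuc) E) ∧ (isCliqueOnᵇ (removeZero G) E ∧ s))
      ≡⟨ cong (λ a → p fzero ∧ (a ∧ (isCliqueOnᵇ (removeZero G) E ∧ s))) (sym (all-∧ (p ∘ fsuc) (adj G fzero ∘ fsuc) E)) ⟩
    p fzero ∧ cliqueWithinᵇ (removeZero G) (λ i → p (fsuc i) ∧ adj G fzero (fsuc i)) k T ∎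
    where
    open ≡-Reasoning
    E = elems T
    s = ∣ T ∣ ≡ᵇ k
    shuffle : ∀ a b c d e → (a ∧ b) ∧ ((c ∧ d) ∧ e) ≡ a ∧ ((b ∧ c) ∧ (d ∧ e))
    shuffle true  true  true  d e = refl
    shuffle true  true  false d e = refl
    shuffle true  false c     d e = refl
    shuffle false b     c     d e = refl

countSubsets-cliqueWithinᵇ : ∀ n (G : Graph n) p k →
  countSubsets (cliqueWithinᵇ G p k) ≡ countCliques (adj G) (filterᵇ p (allFin n)) k
countSubsets-cliqueWithinᵇ zero    G p zero    = refl
countSubsets-cliqueWithinᵇ zero    G p (suc k) = refl
countSubsets-cliqueWithinᵇ (suc n) G p k =
  trans (countSubsets-suc (cliqueWithinᵇ G p k))
        (trans (cong (_+ countSubsets (cliqueWithinᵇ G p k ∘ (true ∷_))) avoidingZero) (containingZero k))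
  where
  open ≡-Reasoning
  G⁻ = removeZero G
  M = filterᵇ (p ∘ fsuc) (allFin n)
  q : Fin n → Bool
  q i = p (fsuc i) ∧ adj G fzero (fsuc i)

  avoidingZero : countSubsets (cliqueWithinᵇ G p k ∘ (false ∷_)) ≡ countCliques (adj G⁻) M k
  avoidingZero = trans (countSubsets-cong (cliqueWithinᵇ-false∷ G p k)) (countSubsets-cliqueWithinᵇ n G⁻ (p ∘ fsuc) k)

  nbhdZero : ∀ j → countCliques (adj G⁻) (filterᵇ q (allFin n)) j
                     ≡ countCliques (adj G) (filterᵇ (adj G fzero) (map fsuc M)) j
  nbhdZero j = begin
    countCliques (adj G⁻) (filterᵇ q (allFin n)) j
      ≡⟨ cong (λ L → countCliques (adj G⁻) L j) (sym (filterᵇ-filterᵇ (adj G fzero ∘ fsuc) (p ∘ fsuc) (allFin n))) ⟩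
    countCliques (adj G⁻) (filterᵇ (adj G fzero ∘ fsuc) M) j
      ≡⟨ sym (countCliques-map (adj G) fsuc (filterᵇ (adj G fzero ∘ fsuc) M) j) ⟩
    countCliques (adj G) (map fsuc (filterᵇ (adj G fzero ∘ fsuc) M)) j
      ≡⟨ cong (λ L → countCliques (adj G) L j) (sym (filterᵇ-map (adj G fzero) fsuc M)) ⟩
    countCliques (adj G) (filterᵇ (adj G fzero) (map fsuc M)) j ∎

  containingZero : ∀ j → countCliques (adj G⁻) M j + countSubsets (cliqueWithinᵇ G p j ∘ (true ∷_))
                           ≡ countCliques (adj G) (filterᵇ p (allFin (suc n))) j
  containingZero zero = begin
    countCliques (adj G⁻) M 0 + countSubsets (cliqueWithinᵇ G p 0 ∘ (true ∷_))
      ≡⟨ cong₂ _+_ (countCliques-zero (adj G⁻) M)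
                   (trans (countSubsets-cong (cliqueWithinᵇ-true∷-zero G p)) (length-filterᵇ-false (allSubsets n))) ⟩
    1
      ≡⟨ sym (countCliques-zero (adj G) (filterᵇ p (allFin (suc n)))) ⟩
    countCliques (adj G) (filterᵇ p (allFin (suc n))) 0 ∎
  containingZero (suc j) = begin
    countCliques (adj G⁻) M (suc j) + countSubsets (cliqueWithinᵇ G p (suc j) ∘ (true ∷_))
      ≡⟨ cong₂ _+_ (sym (countCliques-map (adj G) fsuc M (suc j))) throughZero ⟩
    countCliques (adj G) (map fsuc M) (suc j) + (if p fzero then countCliques (adj G) (filterᵇ (adj G fzero) (map fsuc M)) j else 0)
      ≡⟨ sym (countCliques-if∷ (adj G) (p fzero) fzero (map fsuc M) j) ⟩
    countCliques (adj G) (if p fzero then fzero ∷ map fsuc M else map fsuc M) (suc j)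
      ≡⟨ cong (λ L → countCliques (adj G) L (suc j)) (sym (filterᵇ-allFin-suc p)) ⟩
    countCliques (adj G) (filterᵇ p (allFin (suc n))) (suc j) ∎
    where
    throughZero : countSubsets (cliqueWithinᵇ G p (suc j) ∘ (true ∷_))
                  ≡ (if p fzero then countCliques (adj G) (filterᵇ (adj G fzero) (map fsuc M)) j else 0)
    throughZero = begin
      countSubsets (cliqueWithinᵇ G p (suc j) ∘ (true ∷_))
        ≡⟨ countSubsets-cong (cliqueWithinᵇ-true∷-suc G p j) ⟩
      countSubsets (λ T → p fzero ∧ cliqueWithinᵇ G⁻ q j T)
        ≡⟨ length-filterᵇ-∧ (p fzero) (cliqueWithinᵇ G⁻ q j) (allSubsets n) ⟩
      (if p fzero then countSubsets (cliqueWithinᵇ G⁻ q j) else 0)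
        ≡⟨ cong (λ c → if p fzero then c else 0) (trans (countSubsets-cliqueWithinᵇ n G⁻ q j) (nbhdZero j)) ⟩
      (if p fzero then countCliques (adj G) (filterᵇ (adj G fzero) (map fsuc M)) j else 0) ∎

cliqueCount-countCliques : ∀ {n} (G : Graph n) k → cliqueCount G k ≡ countCliques (adj G) (allFin n) k
cliqueCount-countCliques {n} G k = begin
  countSubsets (λ S → isCliqueᵇ G S ∧ (∣ S ∣ ≡ᵇ k))
    ≡⟨ countSubsets-cong (λ S → sym (cong₂ (λ a c → a ∧ (c ∧ (∣ S ∣ ≡ᵇ k))) (all-true (elems S)) (sym (isCliqueᵇ-isCliqueOnᵇ G S)))) ⟩
  countSubsets (cliqueWithinᵇ G (λ _ → true) k)
    ≡⟨ countSubsets-cliqueWithinᵇ n G (λ _ → true) k ⟩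
  countCliques (adj G) (filterᵇ (λ _ → true) (allFin n)) k
    ≡⟨ cong (λ L → countCliques (adj G) L k) (filter-all (T? ∘ λ _ → true) (universal (λ _ → tt) (allFin n))) ⟩
  countCliques (adj G) (allFin n) k ∎
  where open ≡-Reasoning

cliqueCount-induced : ∀ {n} (G : Graph n) W k → cliqueCount (induced G W) k ≡ countCliques (adj G) (elems W) k
cliqueCount-induced G W k = begin
  cliqueCount (induced G W) k
    ≡⟨ cliqueCount-countCliques (induced G W) k ⟩
  countCliques (adj (induced G W)) (allFin (length (elems W))) k
    ≡⟨ sym (countCliques-map (adj G) (List.lookup (elems W)) (allFin _) k) ⟩
  countCliques (adj G) (map (List.lookup (elems W)) (allFin (length (elems W)))) k
    ≡⟨ cong (λ L → countCliques (adj G) L k) (trans (map-tabulate id (List.lookup (elems W))) (tabulate-lookup (elems W))) ⟩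
  countCliques (adj G) (elems W) k ∎
  where open ≡-Reasoning

elems-edgeNbhd : ∀ {n} (G : Graph n) u v → elems (edgeNbhd G u v) ≡ filterᵇ (λ w → adj G u w ∧ adj G v w) (allFin n)
elems-edgeNbhd {n} G u v = filterᵇ-cong (allFin n) λ w →
  trans (lookup-zipWith _∧_ w (nbhd G u) (nbhd G v))
        (cong₂ _∧_ (lookup∘tabulate (adj G u) w) (lookup∘tabulate (adj G v) w))

∑-sumPoly : ∀ (F : A → Poly) xs k → sumPoly (map F xs) k ≡ (∑[ x ∈ xs ] F x k)
∑-sumPoly F []       k = refl
∑-sumPoly F (x ∷ xs) k = cong (F x k +_) (∑-sumPoly F xs k)

∑∑-symmetrize : ∀ (h : A → A → ℕ) xs → (∑[ u ∈ xs ] ∑[ v ∈ xs ] h u v + h v u) ≡ 2 * (∑[ u ∈ xs ] ∑[ v ∈ xs ] h u v)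
∑∑-symmetrize h xs = begin
  (∑[ u ∈ xs ] ∑[ v ∈ xs ] h u v + h v u)
    ≡⟨ ∑-cong xs (λ u → ∑-distrib-+ (h u) (λ v → h v u) xs) ⟩
  (∑[ u ∈ xs ] (∑[ v ∈ xs ] h u v) + (∑[ v ∈ xs ] h v u))
    ≡⟨ ∑-distrib-+ _ _ xs ⟩
  S + (∑[ u ∈ xs ] ∑[ v ∈ xs ] h v u)
    ≡⟨ cong (S +_) (trans (∑-comm (λ u v → h v u) xs xs) (sym (+-identityʳ S))) ⟩
  2 * S ∎
  where
  open ≡-Reasoning
  S = ∑[ u ∈ xs ] ∑[ v ∈ xs ] h u v

module _ {n : ℕ} (G : Graph n) where

  private
    V = allFin n

  orientedᵇ : Fin n → Fin n → Bool
  orientedᵇ u v = (toℕ u <ᵇ toℕ v) ∧ adj G u v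

  adj-orientedᵇ : ∀ (g : Fin n → Fin n → ℕ) → (∀ u v → g u v ≡ g v u) → ∀ u v →
    (if adj G u v then g u v else 0) ≡ (if orientedᵇ u v then g u v else 0) + (if orientedᵇ v u then g v u else 0)
  adj-orientedᵇ g g-sym u v
    with toℕ u <ᵇ toℕ v | <ᵇ-reflects-< (toℕ u) (toℕ v) | toℕ v <ᵇ toℕ u | <ᵇ-reflects-< (toℕ v) (toℕ u)
  ... | true  | ofʸ u<v | true  | ofʸ v<u = ⊥-elim (<-asym u<v v<u)
  ... | true  | _       | false | _       = sym (+-identityʳ _)
  ... | false | _       | true  | _       = cong₂ (λ b m → if b then m else 0) (adj-sym G u v) (g-sym u v)
  ... | false | ofⁿ u≮v | false | ofⁿ v≮u
    with toℕ-injective {i = u} {j = v} (≤-antisym (≮⇒≥ v≮u) (≮⇒≥ u≮v))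
  ...   | refl rewrite adj-irrefl G u = refl

  cliqueCount-edgeNbhd : ∀ u v k → cliqueCount (induced G (edgeNbhd G u v)) k ≡ countCliques (adj G) (filterᵇ (λ w → adj G u w ∧ adj G v w) V) k
  cliqueCount-edgeNbhd u v k = trans (cliqueCount-induced G (edgeNbhd G u v) k) (cong (λ L → countCliques (adj G) L k) (elems-edgeNbhd G u v))

  second-derivative-∑∑ : ∀ k → deriv (deriv (cliquePoly G)) k
    ≡ (∑[ u ∈ V ] ∑[ v ∈ V ] (if adj G u v then countCliques (adj G) (filterᵇ (λ w → adj G u w ∧ adj G v w) V) k else 0))
  second-derivative-∑∑ k = begin
    suc k * (suc (suc k) * cliqueCount G (suc (suc k)))
      ≡⟨ cong (λ c → suc k * (suc (suc k) * c)) (cliqueCount-countCliques G (suc (suc k))) ⟩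
    suc k * (suc (suc k) * cc V (suc (suc k)))
      ≡⟨ cong (suc k *_) (sym (∑-countCliques-nbhd E (adj-sym G) (adj-irrefl G) (suc k) V)) ⟩
    suc k * (∑[ u ∈ V ] cc (filterᵇ (E u) V) (suc k))
      ≡⟨ *-distribˡ-∑ (suc k) _ V ⟩
    (∑[ u ∈ V ] suc k * cc (filterᵇ (E u) V) (suc k))
      ≡⟨ ∑-cong V (λ u → sym (∑-countCliques-nbhd E (adj-sym G) (adj-irrefl G) k (filterᵇ (E u) V))) ⟩
    (∑[ u ∈ V ] ∑[ v ∈ filterᵇ (E u) V ] cc (filterᵇ (E v) (filterᵇ (E u) V)) k)
      ≡⟨ ∑-cong V (λ u → ∑-filter (T? ∘ E u) _ V) ⟩
    (∑[ u ∈ V ] ∑[ v ∈ V ] (if E u v then cc (filterᵇ (E v) (filterᵇ (E u) V)) k else 0))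
      ≡⟨ ∑-cong V (λ u → ∑-cong V (λ v → cong (λ L → if E u v then cc L k else 0) (filterᵇ-filterᵇ (E v) (E u) V))) ⟩
    (∑[ u ∈ V ] ∑[ v ∈ V ] (if E u v then cc (filterᵇ (λ w → E u w ∧ E v w) V) k else 0)) ∎
    where
    open ≡-Reasoning
    E = adj G
    cc = countCliques E

  sumPoly-edges : ∀ (F : Fin n × Fin n → Poly) k →
    sumPoly (map F (edges G)) k ≡ (∑[ u ∈ V ] ∑[ v ∈ V ] (if orientedᵇ u v then F (u , v) k else 0))
  sumPoly-edges F k = begin
    sumPoly (map F (edges G)) k
      ≡⟨ ∑-sumPoly F (edges G) k ⟩
    (∑[ e ∈ edges G ] F e k)
      ≡⟨ ∑-filter _ (λ e → F e k) pairs ⟩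
    (∑[ e ∈ pairs ] (if orientedᵇ (proj₁ e) (proj₂ e) then F e k else 0))
      ≡⟨ ∑-concatMap _ (λ u → map (u ,_) V) V ⟩
    (∑[ u ∈ V ] ∑[ e ∈ map (u ,_) V ] (if orientedᵇ (proj₁ e) (proj₂ e) then F e k else 0))
      ≡⟨ ∑-cong V (λ u → ∑-map _ (u ,_) V) ⟩
    (∑[ u ∈ V ] ∑[ v ∈ V ] (if orientedᵇ u v then F (u , v) k else 0)) ∎
    where
    open ≡-Reasoning
    pairs = concatMap (λ u → map (u ,_) V) V

mainTheorem5 : ∀ {n} (G : Graph n) (k : ℕ) →
    deriv (deriv (cliquePoly G)) k
    ≡ (2 !) * sumPoly (map (λ { (u , v) → cliquePoly (induced G (edgeNbhd G u v)) }) (edges G)) k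
mainTheorem5 {n} G k = begin
  deriv (deriv (cliquePoly G)) k
    ≡⟨ second-derivative-∑∑ G k ⟩
  (∑[ u ∈ V ] ∑[ v ∈ V ] (if adj G u v then g u v else 0))
    ≡⟨ ∑-cong V (λ u → ∑-cong V (adj-orientedᵇ G g g-sym u)) ⟩
  (∑[ u ∈ V ] ∑[ v ∈ V ] h u v + h v u)
    ≡⟨ ∑∑-symmetrize h V ⟩
  2 * (∑[ u ∈ V ] ∑[ v ∈ V ] h u v)
    ≡⟨ cong (2 *_) (∑-cong V (λ u → ∑-cong V (λ v → cong (λ m → if orientedᵇ G u v then m else 0) (sym (cliqueCount-edgeNbhd G u v k))))) ⟩
  2 * (∑[ u ∈ V ] ∑[ v ∈ V ] (if orientedᵇ G u v then cliqueCount (induced G (edgeNbhd G u v)) k else 0))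
    ≡⟨ cong (2 *_) (sym (sumPoly-edges G _ k)) ⟩
  (2 !) * sumPoly (map (λ { (u , v) → cliquePoly (induced G (edgeNbhd G u v)) }) (edges G)) k ∎
  where
  open ≡-Reasoning
  V = allFin n
  g : Fin n → Fin n → ℕ
  g u v = countCliques (adj G) (filterᵇ (λ w → adj G u w ∧ adj G v w) V) k
  g-sym : ∀ u v → g u v ≡ g v u
  g-sym u v = cong (λ L → countCliques (adj G) L k) (filterᵇ-cong V (λ w → ∧-comm (adj G u w) (adj G v w)))
  h : Fin n → Fin n → ℕ
  h u v = if orientedᵇ G u v then g u v else 0
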